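{- The ${\mathcal U}_{\mathbf C}$-linear map $\epsilon : {\mathcal U}_{\mathbf C} \Sigma \to \Omega_{\mathbf C}^1$, $\epsilon(\langle c_i\rangle) = d\tilde c_i$, is an epimorphism.
   Context: ${\mathbf C}=\mathrm{Cl}(\Sigma,E)$ is the CCC presented by a signature $\Sigma=\{c_1:T_{c_1}\to T'_{c_1},\dots,c_n:T_{c_n}\to T'_{c_n}\}$ ($T'_{c_i}$ base types) and an equation system $E$ (lambda terms with products/unit), and $\tilde c_i=(x:T_{c_i}\mid_E c_i\,x)$. ${\mathcal U}_{\mathbf C}$ is the enveloping ringoid: objects are morphisms of ${\mathbf C}$, generated over ${\mathbb Q}$ by $\partial_{\square_i}(\omega)_{(f_1,\dots,f_n)}:f_i\to\omega\cdot(f_1,\dots,f_n)$ for CCC operations $\omega$ (strict cartesian closed functors $\mathrm{Cl}(\{T\to T'\})\to\mathrm{Cl}(\{\square_1,\dots,\square_n\})$ between free CCCs, determined by the image of the generator; $\mathrm{op}(\tau)$ denotes the one determined by $\tau$), subject to a chain rule and $\partial_{\square_j}(\iota_i)=\delta_{ij}\mathrm{id}$. $\Omega^1_{\mathbf C}$ is the ${\mathcal U}_{\mathbf C}$-module with a generator $df\in\Omega^1_{\mathbf C}(f)$ for each morphism $f$ and relations $d(\omega\cdot(f_1,\dots,f_m))=\sum_i\partial_{\square_i}(\omega)_{(f_1,\dots,f_m)}df_i$. ${\mathcal U}_{\mathbf C}\Sigma$ is the free ${\mathcal U}_{\mathbf C}$-module on $\Sigma$, where $\Sigma$ is viewed as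 the family $f\mapsto\{c_i\mid\tilde c_i=f\}$, with generators $\langle c_i\rangle$. -}

module Defs where

open import Data.Nat using (ℕ; zero; suc)
open import Data.Fin using (Fin; zero; suc)
open import Data.List using (List; []; _∷_)
open import Data.Empty using (⊥)
open import Data.Unit using (⊤; tt)
open import Data.Product using (Σ; ∃; _,_)
open import Data.Rational using (ℚ; 0ℚ; 1ℚ) renaming (_+_ to _+ℚ_; _*_ to _*ℚ_)
open import Relation.Binary.PropositionalEquality using (_≡_; _≢_)

infixr 7 _⇒_
infixr 8 _⊗_

data Ty (B : Set) : Set where
  base : B → Ty B
  𝟙    : Ty B
  _⊗_  : Ty B → Ty B → Ty B
  _⇒_  : Ty B → Ty B → Ty B

Ctx : Set → Set
Ctx B = List (Ty B)

data _∋_ {B : Set} : Ctx B → Ty B → Set where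
  here  : ∀ {Γ A} → (A ∷ Γ) ∋ A
  there : ∀ {Γ A C} → Γ ∋ A → (C ∷ Γ) ∋ A

record Sig (B : Set) : Set₁ where
  field
    Op  : Set
    dom : Op → Ty B
    cod : Op → Ty B
open Sig public

data Tm {B : Set} (S : Sig B) (Γ : Ctx B) : Ty B → Set where
  var  : ∀ {A} → Γ ∋ A → Tm S Γ A
  con  : (c : Op S) → Tm S Γ (dom S c) → Tm S Γ (cod S c)
  ⟨⟩   : Tm S Γ 𝟙
  pair : ∀ {A C} → Tm S Γ A → Tm S Γ C → Tm S Γ (A ⊗ C)
  π₁   : ∀ {A C} → Tm S Γ (A ⊗ C) → Tm S Γ A
  π₂   : ∀ {A C} → Tm S Γ (A ⊗ C) → Tm S Γ C
  ƛ    : ∀ {A C} → Tm S (A ∷ Γ) C → Tm S Γ (A ⇒ C)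
  app  : ∀ {A C} → Tm S Γ (A ⇒ C) → Tm S Γ A → Tm S Γ C

module _ {B : Set} {S : Sig B} where

  Ren : Ctx B → Ctx B → Set
  Ren Γ Δ = ∀ {A} → Γ ∋ A → Δ ∋ A

  ext : ∀ {Γ Δ A} → Ren Γ Δ → Ren (A ∷ Γ) (A ∷ Δ)
  ext ρ here      = here
  ext ρ (there x) = there (ρ x)

  ren : ∀ {Γ Δ A} → Ren Γ Δ → Tm S Γ A → Tm S Δ A
  ren ρ (var x)    = var (ρ x)
  ren ρ (con c t)  = con c (ren ρ t)
  ren ρ ⟨⟩         = ⟨⟩
  ren ρ (pair t u) = pair (ren ρ t) (ren ρ u)
  ren ρ (π₁ t)     = π₁ (ren ρ t)
  ren ρ (π₂ t)     = π₂ (ren ρ t)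
  ren ρ (ƛ t)      = ƛ (ren (ext ρ) t)
  ren ρ (app t u)  = app (ren ρ t) (ren ρ u)

  Sub : Ctx B → Ctx B → Set
  Sub Γ Δ = ∀ {A} → Γ ∋ A → Tm S Δ A

  exts : ∀ {Γ Δ A} → Sub Γ Δ → Sub (A ∷ Γ) (A ∷ Δ)
  exts σ here      = var here
  exts σ (there x) = ren there (σ x)

  sub : ∀ {Γ Δ A} → Sub Γ Δ → Tm S Γ A → Tm S Δ A
  sub σ (var x)    = σ x
  sub σ (con c t)  = con c (sub σ t)
  sub σ ⟨⟩         = ⟨⟩
  sub σ (pair t u) = pair (sub σ t) (sub σ u)
  sub σ (π₁ t)     = π₁ (sub σ t)
  sub σ (π₂ t)     = π₂ (sub σ t)
  sub σ (ƛ t)      = ƛ (sub (exts σ) t)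
  sub σ (app t u)  = app (sub σ t) (sub σ u)

  σ₀ : ∀ {Γ A} → Tm S Γ A → Sub (A ∷ Γ) Γ
  σ₀ u here      = u
  σ₀ u (there x) = var x

  only : ∀ {Γ A} → Tm S Γ A → Sub (A ∷ []) Γ
  only u here = u

record EqSys {B : Set} (S : Sig B) : Set₁ where
  field
    Ix  : Set
    ctx : Ix → Ctx B
    ty  : Ix → Ty B
    lhs : (e : Ix) → Tm S (ctx e) (ty e)
    rhs : (e : Ix) → Tm S (ctx e) (ty e)

noEqs : {B : Set} (S : Sig B) → EqSys S
noEqs S = record { Ix = ⊥ ; ctx = λ () ; ty = λ () ; lhs = λ () ; rhs = λ () }

data Conv {B : Set} {S : Sig B} (E : EqSys S) {Γ : Ctx B} :
          {A : Ty B} → Tm S Γ A → Tm S Γ A → Set where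
  c-refl  : ∀ {A} {t : Tm S Γ A} → Conv E t t
  c-sym   : ∀ {A} {t u : Tm S Γ A} → Conv E t u → Conv E u t
  c-trans : ∀ {A} {t u v : Tm S Γ A} → Conv E t u → Conv E u v → Conv E t v
  c-con   : ∀ c {t u} → Conv E t u → Conv E (con c t) (con c u)
  c-pair  : ∀ {A C} {t t' : Tm S Γ A} {u u' : Tm S Γ C} →
            Conv E t t' → Conv E u u' → Conv E (pair t u) (pair t' u')
  c-π₁    : ∀ {A C} {t t' : Tm S Γ (A ⊗ C)} → Conv E t t' → Conv E (π₁ t) (π₁ t')
  c-π₂    : ∀ {A C} {t t' : Tm S Γ (A ⊗ C)} → Conv E t t' → Conv E (π₂ t) (π₂ t')
  c-ƛ     : ∀ {A C} {t t' : Tm S (A ∷ Γ) C} → Conv E t t' → Conv E (ƛ t) (ƛ t')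
  c-app   : ∀ {A C} {t t' : Tm S Γ (A ⇒ C)} {u u' : Tm S Γ A} →
            Conv E t t' → Conv E u u' → Conv E (app t u) (app t' u')
  β-π₁    : ∀ {A C} {t : Tm S Γ A} {u : Tm S Γ C} → Conv E (π₁ (pair t u)) t
  β-π₂    : ∀ {A C} {t : Tm S Γ A} {u : Tm S Γ C} → Conv E (π₂ (pair t u)) u
  β-ƛ     : ∀ {A C} {t : Tm S (A ∷ Γ) C} {u : Tm S Γ A} →
            Conv E (app (ƛ t) u) (sub (σ₀ u) t)
  η-𝟙     : {t : Tm S Γ 𝟙} → Conv E t ⟨⟩
  η-⊗     : ∀ {A C} {t : Tm S Γ (A ⊗ C)} → Conv E t (pair (π₁ t) (π₂ t))
  η-⇒     : ∀ {A C} {t : Tm S Γ (A ⇒ C)} →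
            Conv E t (ƛ (app (ren there t) (var here)))
  ax      : (e : EqSys.Ix E) (σ : Sub (EqSys.ctx E e) Γ) →
            Conv E (sub σ (EqSys.lhs E e)) (sub σ (EqSys.rhs E e))

-- Interpretation of a signature S₁ in terms over S₂ (a strict cartesian
-- closed functor Cl(S₁) → Cl(S₂), identity on base types, determined by
-- the images of the generators).

interp : {B : Set} {S₁ S₂ : Sig B} →
         ((c : Op S₁) → Tm S₂ (dom S₁ c ∷ []) (cod S₁ c)) →
         ∀ {Γ A} → Tm S₁ Γ A → Tm S₂ Γ A
interp ρ (var x)    = var x
interp ρ (con c t)  = sub (only (interp ρ t)) (ρ c)
interp ρ ⟨⟩         = ⟨⟩
interp ρ (pair t u) = pair (interp ρ t) (interp ρ u)
interp ρ (π₁ t)     = π₁ (interp ρ t)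
interp ρ (π₂ t)     = π₂ (interp ρ t)
interp ρ (ƛ t)      = ƛ (interp ρ t)
interp ρ (app t u)  = app (interp ρ t) (interp ρ u)

-- Box signatures {□₁ : A₁ → B₁, …, □ₖ : Aₖ → Bₖ} (free CCCs)

record Arity (B : Set) : Set where
  constructor arity
  field
    ar : ℕ
    dA : Fin ar → Ty B
    dB : Fin ar → Ty B
open Arity public

BoxSig : {B : Set} → Arity B → Sig B
BoxSig α = record { Op = Fin (ar α) ; dom = dA α ; cod = dB α }

-- CCC operations with boxes of arity α, from T to T': a morphism
-- T → T' of the free CCC Cl({□ᵢ}), i.e. a term τ up to pure βη (Conv₀).
Oper : {B : Set} → Arity B → Ty B → Ty B → Set
Oper α T T' = Tm (BoxSig α) (T ∷ []) T'

Conv₀ : {B : Set} {α : Arity B} {T T' : Ty B} → Oper α T T' → Oper α T T' → Set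
Conv₀ {α = α} = Conv (noEqs (BoxSig α))

ΣFin : {X : Set} → X → (X → X → X) → (k : ℕ) → (Fin k → X) → X
ΣFin z _⊕_ zero    x = z
ΣFin z _⊕_ (suc k) x = x zero ⊕ ΣFin z _⊕_ k (λ i → x (suc i))

-- The paper's setting: C = Cl(Σ, E) for Σ = {cᵢ : T_cᵢ → T'_cᵢ}, T'_cᵢ base.

ΣSig : {B : Set} (n : ℕ) → (Fin n → Ty B) → (Fin n → B) → Sig B
ΣSig n domc codc = record { Op = Fin n ; dom = domc ; cod = λ i → base (codc i) }

module Paper (B : Set) (n : ℕ) (domc : Fin n → Ty B) (codc : Fin n → B)
             (E : EqSys (ΣSig n domc codc)) where

  SΣ : Sig B
  SΣ = ΣSig n domc codc

  -- morphisms of C (representatives; equality is _≋_)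
  record Mor : Set where
    constructor mor
    field
      src : Ty B
      tgt : Ty B
      tm  : Tm SΣ (src ∷ []) tgt

  infix 4 _≋_
  infix 8 _·_
  data _≋_ : Mor → Mor → Set where
    mk≋ : ∀ {A C} {t u : Tm SΣ (A ∷ []) C} → Conv E t u → mor A C t ≋ mor A C u

  c̃ : Fin n → Mor
  c̃ i = mor (domc i) (base (codc i)) (con i (var here))

  Args : Arity B → Set
  Args α = (i : Fin (ar α)) → Tm SΣ (dA α i ∷ []) (dB α i)

  argMor : {α : Arity B} → Args α → Fin (ar α) → Mor
  argMor {α} fs i = mor (dA α i) (dB α i) (fs i)

  _·_ : {α : Arity B} {T T' : Ty B} → Oper α T T' → Args α → Mor
  _·_ {T = T} {T'} τ fs = mor T T' (interp fs τ)

  _∘ₒ_ : {α β : Arity B} {T T' : Ty B} → Oper α T T' →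
         ((j : Fin (ar α)) → Oper β (dA α j) (dB α j)) → Oper β T T'
  τ ∘ₒ τs = interp τs τ

  ι : (α : Arity B) (i : Fin (ar α)) → Oper α (dA α i) (dB α i)
  ι α i = con i (var here)

  -- The enveloping ringoid U_C: free ℚ-linear category on the generators
  -- ∂_{□ᵢ}(ω)_(f₁,…,fₖ) : fᵢ → ω·(f₁,…,fₖ), modulo the chain rule and
  -- ∂_{□ⱼ}(ιᵢ) = δᵢⱼ id.  Objects are morphisms of C; E-equal morphisms
  -- are identified through the canonical isomorphisms idE.

  infixr 9 _∘U_
  infixl 6 _+U_
  infixr 7 _*U_

  data U : Mor → Mor → Set where
    idU  : ∀ {f} → U f f
    _∘U_ : ∀ {f g h} → U g h → U f g → U f h
    0U   : ∀ {f g} → U f g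
    _+U_ : ∀ {f g} → U f g → U f g → U f g
    _*U_ : ∀ {f g} → ℚ → U f g → U f g
    ∂    : {α : Arity B} {T T' : Ty B} (τ : Oper α T T') (i : Fin (ar α))
           (fs : Args α) → U (argMor fs i) (τ · fs)
    idE  : ∀ {f g} → f ≋ g → U f g

  ΣU : ∀ {f g} (k : ℕ) → (Fin k → U f g) → U f g
  ΣU = ΣFin 0U _+U_

  infix 4 _≈U_
  data _≈U_ : ∀ {f g} → U f g → U f g → Set where
    u-refl  : ∀ {f g} {x : U f g} → x ≈U x
    u-sym   : ∀ {f g} {x y : U f g} → x ≈U y → y ≈U x
    u-trans : ∀ {f g} {x y z : U f g} → x ≈U y → y ≈U z → x ≈U z
    u-∘     : ∀ {f g h} {x x' : U g h} {y y' : U f g} →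
              x ≈U x' → y ≈U y' → x ∘U y ≈U x' ∘U y'
    u-+     : ∀ {f g} {x x' y y' : U f g} → x ≈U x' → y ≈U y' → x +U y ≈U x' +U y'
    u-*     : ∀ {f g} (q : ℚ) {x x' : U f g} → x ≈U x' → q *U x ≈U q *U x'
    u-+assoc : ∀ {f g} (x y z : U f g) → (x +U y) +U z ≈U x +U (y +U z)
    u-+comm  : ∀ {f g} (x y : U f g) → x +U y ≈U y +U x
    u-+0     : ∀ {f g} (x : U f g) → x +U 0U ≈U x
    u-1*     : ∀ {f g} (x : U f g) → 1ℚ *U x ≈U x
    u-0*     : ∀ {f g} (x : U f g) → 0ℚ *U x ≈U 0U
    u-**     : ∀ {f g} (p q : ℚ) (x : U f g) → (p *ℚ q) *U x ≈U p *U (q *U x)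
    u-+*     : ∀ {f g} (p q : ℚ) (x : U f g) → (p +ℚ q) *U x ≈U p *U x +U q *U x
    u-*+     : ∀ {f g} (q : ℚ) (x y : U f g) → q *U (x +U y) ≈U q *U x +U q *U y
    u-assoc : ∀ {f g h k} (x : U h k) (y : U g h) (z : U f g) →
              (x ∘U y) ∘U z ≈U x ∘U (y ∘U z)
    u-idˡ   : ∀ {f g} (x : U f g) → idU ∘U x ≈U x
    u-idʳ   : ∀ {f g} (x : U f g) → x ∘U idU ≈U x
    u-+∘    : ∀ {f g h} (x y : U g h) (z : U f g) → (x +U y) ∘U z ≈U x ∘U z +U y ∘U z
    u-∘+    : ∀ {f g h} (x : U g h) (y z : U f g) → x ∘U (y +U z) ≈U x ∘U y +U x ∘U z
    u-*∘    : ∀ {f g h} (q : ℚ) (x : U g h) (z : U f g) → (q *U x) ∘U z ≈U q *U (x ∘U z)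
    u-∘*    : ∀ {f g h} (q : ℚ) (x : U g h) (z : U f g) → x ∘U (q *U z) ≈U q *U (x ∘U z)
    u-0∘    : ∀ {f g h} (z : U f g) → (0U {g} {h}) ∘U z ≈U 0U
    u-∘0    : ∀ {f g h} (x : U g h) → x ∘U (0U {f} {g}) ≈U 0U
    u-idE-id : ∀ {f} (p : f ≋ f) → idE p ≈U idU
    u-idE-∘  : ∀ {f g h} (p : g ≋ h) (q : f ≋ g) (r : f ≋ h) → idE p ∘U idE q ≈U idE r
    u-∂-cong : {α : Arity B} {T T' : Ty B} {τ τ' : Oper α T T'} (i : Fin (ar α))
               {fs fs' : Args α} → Conv₀ τ τ' → (∀ j → Conv E (fs j) (fs' j)) →
               (p : τ · fs ≋ τ' · fs') (q : argMor fs i ≋ argMor fs' i) →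
               idE p ∘U ∂ τ i fs ≈U ∂ τ' i fs' ∘U idE q
    u-chain : {α β : Arity B} {T T' : Ty B} (τ : Oper α T T')
              (τs : (j : Fin (ar α)) → Oper β (dA α j) (dB α j))
              (k : Fin (ar β)) (gs : Args β)
              (p : τ · (λ j → interp gs (τs j)) ≋ (τ ∘ₒ τs) · gs) →
              ∂ (τ ∘ₒ τs) k gs ≈U
                ΣU (ar α) (λ j → idE p ∘U (∂ τ j (λ j' → interp gs (τs j')) ∘U
                                           ∂ (τs j) k gs))
    u-ι-same : (α : Arity B) (i : Fin (ar α)) (fs : Args α)
               (p : argMor fs i ≋ (ι α i · fs)) → ∂ (ι α i) i fs ≈U idE p
    u-ι-diff : (α : Arity B) (i j : Fin (ar α)) → j ≢ i → (fs : Args α) →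
               ∂ (ι α i) j fs ≈U 0U

  -- Left U_C-modules presented by generators G and relations R


  infixl 6 _+M_
  infixr 7 _*M_

  data MExp (G : Mor → Set) : Mor → Set where
    0M   : ∀ {f} → MExp G f
    _+M_ : ∀ {f} → MExp G f → MExp G f → MExp G f
    _*M_ : ∀ {f} → ℚ → MExp G f → MExp G f
    act  : ∀ {f g} → U f g → MExp G f → MExp G g
    gen  : ∀ {f} → G f → MExp G f

  ΣM : ∀ {G f} (k : ℕ) → (Fin k → MExp G f) → MExp G f
  ΣM = ΣFin 0M _+M_

  data ModEq (G : Mor → Set) (R : ∀ {f} → MExp G f → MExp G f → Set) :
             ∀ {f} → MExp G f → MExp G f → Set where
    m-rel   : ∀ {f} {x y : MExp G f} → R x y → ModEq G R x y
    m-refl  : ∀ {f} {x : MExp G f} → ModEq G R x x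
    m-sym   : ∀ {f} {x y : MExp G f} → ModEq G R x y → ModEq G R y x
    m-trans : ∀ {f} {x y z : MExp G f} → ModEq G R x y → ModEq G R y z → ModEq G R x z
    m-+     : ∀ {f} {x x' y y' : MExp G f} →
              ModEq G R x x' → ModEq G R y y' → ModEq G R (x +M y) (x' +M y')
    m-*     : ∀ {f} (q : ℚ) {x x' : MExp G f} → ModEq G R x x' → ModEq G R (q *M x) (q *M x')
    m-act   : ∀ {f g} {a a' : U f g} {x x' : MExp G f} →
              a ≈U a' → ModEq G R x x' → ModEq G R (act a x) (act a' x')
    m-+assoc : ∀ {f} (x y z : MExp G f) → ModEq G R ((x +M y) +M z) (x +M (y +M z))
    m-+comm  : ∀ {f} (x y : MExp G f) → ModEq G R (x +M y) (y +M x)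
    m-+0     : ∀ {f} (x : MExp G f) → ModEq G R (x +M 0M) x
    m-1*     : ∀ {f} (x : MExp G f) → ModEq G R (1ℚ *M x) x
    m-0*     : ∀ {f} (x : MExp G f) → ModEq G R (0ℚ *M x) 0M
    m-**     : ∀ {f} (p q : ℚ) (x : MExp G f) → ModEq G R ((p *ℚ q) *M x) (p *M (q *M x))
    m-+*     : ∀ {f} (p q : ℚ) (x : MExp G f) → ModEq G R ((p +ℚ q) *M x) (p *M x +M q *M x)
    m-*+     : ∀ {f} (q : ℚ) (x y : MExp G f) → ModEq G R (q *M (x +M y)) (q *M x +M q *M y)
    m-act-id : ∀ {f} (x : MExp G f) → ModEq G R (act idU x) x
    m-act-∘  : ∀ {f g h} (a : U g h) (b : U f g) (x : MExp G f) →
               ModEq G R (act (a ∘U b) x) (act a (act b x))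
    m-act-+ˡ : ∀ {f g} (a b : U f g) (x : MExp G f) →
               ModEq G R (act (a +U b) x) (act a x +M act b x)
    m-act-*ˡ : ∀ {f g} (q : ℚ) (a : U f g) (x : MExp G f) →
               ModEq G R (act (q *U a) x) (q *M act a x)
    m-act-0ˡ : ∀ {f g} (x : MExp G f) → ModEq G R (act (0U {f} {g}) x) 0M
    m-act-+ʳ : ∀ {f g} (a : U f g) (x y : MExp G f) →
               ModEq G R (act a (x +M y)) (act a x +M act a y)
    m-act-*ʳ : ∀ {f g} (q : ℚ) (a : U f g) (x : MExp G f) →
               ModEq G R (act a (q *M x)) (q *M act a x)
    m-act-0ʳ : ∀ {f g} (a : U f g) → ModEq G R (act a (0M {f = f})) 0M

  DGen : Mor → Set
  DGen f = ⊤

  d : (f : Mor) → MExp DGen f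
  d f = gen tt

  data ΩRel : ∀ {f} → MExp DGen f → MExp DGen f → Set where
    d-op   : {α : Arity B} {T T' : Ty B} (τ : Oper α T T') (fs : Args α) →
             ΩRel (d (τ · fs)) (ΣM (ar α) (λ i → act (∂ τ i fs) (d (argMor fs i))))
    d-cong : ∀ {f g} (p : f ≋ g) → ΩRel (d g) (act (idE p) (d f))

  Ω¹ : Mor → Set
  Ω¹ = MExp DGen

  _≈Ω_ : ∀ {f} → Ω¹ f → Ω¹ f → Set
  _≈Ω_ = ModEq DGen ΩRel

  -- U_C Σ : free module on Σ viewed as the family f ↦ {cᵢ | c̃ᵢ = f};
  -- generator ⟨cᵢ⟩ ∈ U_CΣ(c̃ᵢ).

  data ΣGen : Mor → Set where
    ⟨_⟩ : (i : Fin n) → ΣGen (c̃ i)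

  data NoRel : ∀ {f} → MExp ΣGen f → MExp ΣGen f → Set where

  UΣ : Mor → Set
  UΣ = MExp ΣGen

  _≈Σ_ : ∀ {f} → UΣ f → UΣ f → Set
  _≈Σ_ = ModEq ΣGen NoRel

  ε : ∀ {f} → UΣ f → Ω¹ f
  ε 0M            = 0M
  ε (x +M y)      = ε x +M ε y
  ε (q *M x)      = q *M ε x
  ε (act a x)     = act a (ε x)
  ε (gen ⟨ i ⟩)   = d (c̃ i)

  εEpi : Set
  εEpi = (f : Mor) (m : Ω¹ f) → ∃ λ (x : UΣ f) → ε x ≈Ω m

{-# OPTIONS --safe #-}
-- Every morphism t of C = Cl(Σ, E) is itself a CCC operation: reading each
-- constant cᵢ in t as the box □ᵢ gives op(t), and op(t) · (c̃₁,…,c̃ₙ) = t.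
-- The defining relation of Ω¹ then gives dt = Σᵢ ∂_{□ᵢ}(op t) dc̃ᵢ
-- = ε(Σᵢ ∂_{□ᵢ}(op t) ⟨cᵢ⟩), and Ω¹ is generated by the dt.
module Submission where

open import Defs
open import Data.Nat using (ℕ; zero; suc)
open import Data.Fin using (Fin; zero; suc)
open import Data.Unit using (tt)
open import Data.Product using (∃; _,_)
open import Function using (_∘_)
open import Relation.Binary.Bundles using (Setoid)
open import Relation.Binary.PropositionalEquality using (_≡_; refl; trans; cong; cong₂)
import Relation.Binary.Reasoning.Setoid as SetoidReasoning

ΣFin-homo : {X Y : Set} {z : X} {_⊕_ : X → X → X} {z' : Y} {_⊕'_ : Y → Y → Y}
            (h : X → Y) → h z ≡ z' → (∀ a b → h (a ⊕ b) ≡ h a ⊕' h b) →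
            (k : ℕ) (xs : Fin k → X) → h (ΣFin z _⊕_ k xs) ≡ ΣFin z' _⊕'_ k (h ∘ xs)
ΣFin-homo h h-z h-⊕ zero    xs = h-z
ΣFin-homo {_⊕'_ = _⊕'_} h h-z h-⊕ (suc k) xs =
  trans (h-⊕ _ _) (cong (h (xs zero) ⊕'_) (ΣFin-homo h h-z h-⊕ k (xs ∘ suc)))

interp-con-var : {B : Set} {S : Sig B} {Γ : Ctx B} {A : Ty B} (t : Tm S Γ A) →
                 interp (λ c → con c (var here)) t ≡ t
interp-con-var (var x)    = refl
interp-con-var (con c t)  = cong (con c) (interp-con-var t)
interp-con-var ⟨⟩         = refl
interp-con-var (pair t u) = cong₂ pair (interp-con-var t) (interp-con-var u)
interp-con-var (π₁ t)     = cong π₁ (interp-con-var t)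
interp-con-var (π₂ t)     = cong π₂ (interp-con-var t)
interp-con-var (ƛ t)      = cong ƛ (interp-con-var t)
interp-con-var (app t u)  = cong₂ app (interp-con-var t) (interp-con-var u)

≡⇒Conv : {B : Set} {S : Sig B} {E : EqSys S} {Γ : Ctx B} {A : Ty B} {t u : Tm S Γ A} →
         t ≡ u → Conv E t u
≡⇒Conv refl = c-refl

module _ (B : Set) (n : ℕ) (domc : Fin n → Ty B) (codc : Fin n → B)
         (E : EqSys (ΣSig n domc codc)) where
  open Paper B n domc codc E

  Ω¹-setoid : Mor → Setoid _ _
  Ω¹-setoid f = record
    { Carrier       = Ω¹ f
    ; _≈_           = _≈Ω_
    ; isEquivalence = record { refl = m-refl ; sym = m-sym ; trans = m-trans }
    }

  ε-ΣM : ∀ {f} (k : ℕ) (xs : Fin k → UΣ f) → ε (ΣM k xs) ≡ ΣM k (ε ∘ xs)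
  ε-ΣM = ΣFin-homo ε refl (λ _ _ → refl)

  -- The boxes □ᵢ : T_cᵢ → T'_cᵢ have the types of the constants, so that
  -- BoxSig Σ-boxes is the signature Σ itself.
  Σ-boxes : Arity B
  Σ-boxes = arity n domc (λ i → base (codc i))

  c̃s : Args Σ-boxes
  c̃s i = con i (var here)

  op : (f : Mor) → Oper Σ-boxes (Mor.src f) (Mor.tgt f)
  op (mor A C t) = t

  op·c̃s≋ : (f : Mor) → op f · c̃s ≋ f
  op·c̃s≋ (mor A C t) = mk≋ (≡⇒Conv (interp-con-var t))

  d∈image-ε : (f : Mor) → ∃ λ (x : UΣ f) → ε x ≈Ω d f
  d∈image-ε f = act (idE p) (ΣM n ∂ᵢ⟨cᵢ⟩) , proof
    where
      open SetoidReasoning (Ω¹-setoid f)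
      p : op f · c̃s ≋ f
      p = op·c̃s≋ f
      ∂ᵢ⟨cᵢ⟩ : Fin n → UΣ (op f · c̃s)
      ∂ᵢ⟨cᵢ⟩ i = act (∂ (op f) i c̃s) (gen ⟨ i ⟩)
      proof : ε (act (idE p) (ΣM n ∂ᵢ⟨cᵢ⟩)) ≈Ω d f
      proof = begin
        act (idE p) (ε (ΣM n ∂ᵢ⟨cᵢ⟩))
          ≡⟨ cong (act (idE p)) (ε-ΣM n ∂ᵢ⟨cᵢ⟩) ⟩
        act (idE p) (ΣM n (λ i → act (∂ (op f) i c̃s) (d (c̃ i))))
          ≈⟨ m-act u-refl (m-rel (d-op (op f) c̃s)) ⟨
        act (idE p) (d (op f · c̃s))
          ≈⟨ m-rel (d-cong p) ⟨
        d f ∎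

  ε-surjective : εEpi
  ε-surjective f 0M = 0M , m-refl
  ε-surjective f (m +M m') with ε-surjective f m | ε-surjective f m'
  ... | x , εx≈m | x' , εx'≈m' = x +M x' , m-+ εx≈m εx'≈m'
  ε-surjective f (q *M m) with ε-surjective f m
  ... | x , εx≈m = q *M x , m-* q εx≈m
  ε-surjective g (act {f} a m) with ε-surjective f m
  ... | x , εx≈m = act a x , m-act u-refl εx≈m
  ε-surjective f (gen tt) = d∈image-ε f

mainTheorem8 : (B : Set) (n : ℕ) (domc : Fin n → Ty B) (codc : Fin n → B)
    (E : EqSys (ΣSig n domc codc)) → Paper.εEpi B n domc codc E
mainTheorem8 = ε-surjective
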